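{- Let a group $G$ act on a set $\Omega$, let $X\subset G$ with $X=X^{ -1}$, fix $a\in\Omega$ and $U\subset\Omega$ containing $a$ such that the full subgraph $\Lambda$ of $\Omega_X$ on $U$ is connected. Let $\rho(g)=g\cdot a$, let $\rho^{ -1}(\Lambda)$ be the full subgraph of $G_X$ on $\rho^{ -1}(U)$, let $C_1$ be its connected component containing $1$, and let $G_a=\{g\in G: g\cdot a=a\}$. Then $\rho$ restricts to a graph isomorphism from each connected component of $\rho^{ -1}(\Lambda)$ onto $\Lambda$ if and only if $C_1\cap G_a=\{1\}$.
   Context: The Cayley graph $G_X$ has vertex set $G$, with an edge marked $x$ from $g$ to $xg$ for each $x\in X$; $\Omega_X$ has vertex set $\Omega$ with an edge marked $x$ from $b$ to $x\cdot b$. A full subgraph on a set of vertices contains all edges of the ambient graph between those vertices. -}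

module Defs where

open import Level using (Level; _⊔_; suc)
open import Algebra.Bundles using (Group)
open import Relation.Binary.Bundles using (Setoid)
open import Relation.Binary.Construct.Closure.ReflexiveTransitive using (Star)
open import Data.Product using (Σ; _×_; ∃; _,_)
open import Data.Sum using (_⊎_)

record GroupAction {c ℓ : Level} (G : Group c ℓ) (o e : Level)
         : Set (suc (c ⊔ ℓ ⊔ o ⊔ e)) where
  open Group G
  field
    Ωs    : Setoid o e
  open Setoid Ωs renaming (Carrier to Ω; _≈_ to _≈Ω_) public
  field
    _·_     : Carrier → Ω → Ω
    ·-cong  : ∀ {g h b b'} → g ≈ h → b ≈Ω b' → (g · b) ≈Ω (h · b')
    ·-ident : ∀ b → (ε · b) ≈Ω b
    ·-assoc : ∀ g h b → ((g ∙ h) · b) ≈Ω (g · (h · b))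

-- The action of G on itself by left multiplication (its graph is G_X).
leftRegular : ∀ {c ℓ} (G : Group c ℓ) → GroupAction G c ℓ
leftRegular G = record
  { Ωs = setoid ; _·_ = _∙_ ; ·-cong = ∙-cong
  ; ·-ident = identityˡ ; ·-assoc = assoc }
  where open Group G

module ActionGraph {c ℓ o e : Level} {G : Group c ℓ} (A : GroupAction G o e)
                   {p : Level} (X : Group.Carrier G → Set p) where
  -- The graph Ω_X: vertex set Ω, an edge marked x from b to x · b for each x ∈ X.
  -- Edges are the pairs (b , x) with x ∈ X; edge (b , x) goes from b to x · b.
  open Group G
  open GroupAction A

  module Full {q : Level} (S : Ω → Set q) where
    IsEdge : Ω → Carrier → Set (p ⊔ q)
    IsEdge b x = X x × S b × S (x · b)

    Step : Ω → Ω → Set (c ⊔ e ⊔ p ⊔ q)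
    Step b b' = (Σ Carrier λ x → IsEdge b x × (x · b) ≈Ω b')
              ⊎ (Σ Carrier λ x → IsEdge b' x × (x · b') ≈Ω b)
              ⊎ (S b × S b' × b ≈Ω b')

    Connected : Ω → Ω → Set (o ⊔ c ⊔ e ⊔ p ⊔ q)
    Connected b b' = S b × S b' × Star Step b b'

    IsConnectedGraph : Set (o ⊔ c ⊔ e ⊔ p ⊔ q)
    IsConnectedGraph = ∀ b b' → S b → S b' → Connected b b'

-- f : Ω₁ → Ω₂ restricts to an isomorphism of (X-labelled) graphs from the
-- full subgraph of (Ω₁)_X on S onto the full subgraph of (Ω₂)_X on T:
-- the vertex map b ↦ f b and the induced edge map (b , x) ↦ (f b , x)
-- form a graph homomorphism and both are bijections.
record RestrictsToIso {c ℓ o₁ e₁ o₂ e₂ p q r : Level} {G : Group c ℓ}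
         (A₁ : GroupAction G o₁ e₁) (A₂ : GroupAction G o₂ e₂)
         (X : Group.Carrier G → Set p)
         (f : GroupAction.Ω A₁ → GroupAction.Ω A₂)
         (S : GroupAction.Ω A₁ → Set q) (T : GroupAction.Ω A₂ → Set r)
         : Set (c ⊔ ℓ ⊔ o₁ ⊔ e₁ ⊔ o₂ ⊔ e₂ ⊔ p ⊔ q ⊔ r) where
  open Group G
  open GroupAction A₁ renaming (Ω to Ω₁; _≈Ω_ to _≈₁_; _·_ to _·₁_) using ()
  open GroupAction A₂ renaming (Ω to Ω₂; _≈Ω_ to _≈₂_; _·_ to _·₂_) using ()
  open ActionGraph A₁ X using () renaming (module Full to Full₁)
  open ActionGraph A₂ X using () renaming (module Full to Full₂)
  open Full₁ S using () renaming (IsEdge to Edge₁)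
  open Full₂ T using () renaming (IsEdge to Edge₂)
  field
    vertex-maps : ∀ b → S b → T (f b)
    edge-maps   : ∀ b x → Edge₁ b x → Edge₂ (f b) x × f (x ·₁ b) ≈₂ (x ·₂ f b)
    vertex-inj  : ∀ b b' → S b → S b' → f b ≈₂ f b' → b ≈₁ b'
    vertex-surj : ∀ t → T t → Σ Ω₁ λ b → S b × f b ≈₂ t
    edge-inj    : ∀ b x b' x' → Edge₁ b x → Edge₁ b' x' →
                  f b ≈₂ f b' → x ≈ x' → b ≈₁ b' × x ≈ x'
    edge-surj   : ∀ t y → Edge₂ t y →
                  Σ Ω₁ λ b → Σ Carrier λ x → Edge₁ b x × f b ≈₂ t × x ≈ y

{-# OPTIONS --safe #-}
module Submission where

-- Right multiplication by k ∈ Gₐ commutes with the left-labelled edges of G_X and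
-- does not change ρ, so it maps components of ρ⁻¹(Λ) onto components over the same
-- part of Λ. Walks in Λ lift to walks in ρ⁻¹(Λ) from any point over their start,
-- so ρ maps every component onto the connected graph Λ. If c, c' ∈ C₁ have the
-- same image, then k = c⁻¹c' ∈ Gₐ and translating a walk from 1 to c by k joins k
-- to c', so k ∈ C₁ ∩ Gₐ; hence a trivial intersection makes ρ injective on C₁.
-- Any other component is moved into C₁ by right multiplication with b⁻¹c ∈ Gₐ,
-- where c ∈ C₁ lies over the same point as one of its vertices b. Conversely, 1 and
-- any g ∈ C₁ ∩ Gₐ are vertices of C₁ with the same image.

open import Defs
open import Level using (Level; _⊔_)
open import Algebra.Bundles using (Group)
import Algebra.Properties.Group as GroupProperties
open import Data.Product using (_×_; Σ; _,_)
open import Data.Sum using (inj₁; inj₂)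
open import Function.Bundles using (_⇔_; mk⇔; Equivalence)
open import Relation.Binary.Bundles using (Setoid)
import Relation.Binary.Reasoning.Setoid as SetoidReasoning
open import Relation.Binary.Construct.Closure.ReflexiveTransitive
  using (Star; ε; _◅_; _◅◅_; gmap; reverse; return)

module ActionProperties {c ℓ o e : Level} {G : Group c ℓ} (A : GroupAction G o e) where
  open Group G using (_⁻¹; inverseˡ)
  open GroupAction A

  ·-inverseˡ : ∀ x b → ((x ⁻¹) · (x · b)) ≈Ω b
  ·-inverseˡ x b = trans (sym (·-assoc (x ⁻¹) x b)) (trans (·-cong (inverseˡ x) refl) (·-ident b))

module FullSubgraph {c ℓ o e p q : Level} {G : Group c ℓ} (A : GroupAction G o e)
    (X : Group.Carrier G → Set p) {S : GroupAction.Ω A → Set q}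
    (S-resp : ∀ {b b'} → GroupAction._≈Ω_ A b b' → S b → S b') where
  open GroupAction A
  open ActionGraph.Full A X S

  step-sym : ∀ {b b'} → Step b b' → Step b' b
  step-sym (inj₁ edge) = inj₂ (inj₁ edge)
  step-sym (inj₂ (inj₁ edge)) = inj₁ edge
  step-sym (inj₂ (inj₂ (sb , sb' , b≈b'))) = inj₂ (inj₂ (sb' , sb , sym b≈b'))

  connected-refl : ∀ {b} → S b → Connected b b
  connected-refl sb = sb , sb , ε

  connected-sym : ∀ {b b'} → Connected b b' → Connected b' b
  connected-sym (sb , sb' , walk) = sb' , sb , reverse step-sym walk

  connected-trans : ∀ {b b' b''} → Connected b b' → Connected b' b'' → Connected b b''
  connected-trans (sb , _ , walk) (_ , sb'' , walk') = sb , sb'' , walk ◅◅ walk'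

  ≈⇒connected : ∀ {b b'} → S b → b ≈Ω b' → Connected b b'
  ≈⇒connected sb b≈b' = sb , S-resp b≈b' sb , return (inj₂ (inj₂ (sb , S-resp b≈b' sb , b≈b')))

  connected-respʳ : ∀ {b b' b''} → b' ≈Ω b'' → Connected b b' → Connected b b''
  connected-respʳ b'≈b'' b~b' @ (_ , sb' , _) = connected-trans b~b' (≈⇒connected sb' b'≈b'')

  connected-respˡ : ∀ {b b' b''} → b ≈Ω b' → Connected b b'' → Connected b' b''
  connected-respˡ b≈b' b~b'' = connected-sym (connected-respʳ b≈b' (connected-sym b~b''))

  edge⇒connected : ∀ {x b} → X x → S b → S (x · b) → Connected b (x · b)
  edge⇒connected x∈X sb sxb = sb , sxb , return (inj₁ (_ , (x∈X , sb , sxb) , refl))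

module RightTranslation {c ℓ p q : Level} {G : Group c ℓ} (X : Group.Carrier G → Set p)
    {S : Group.Carrier G → Set q} (S-resp : ∀ {h h'} → Group._≈_ G h h' → S h → S h')
    {k : Group.Carrier G} (S-∙ʳ : ∀ {h} → S h → S (Group._∙_ G h k)) where
  open Group G
  open ActionGraph.Full (leftRegular G) X S

  edge-∙ʳ : ∀ {h h' x} → IsEdge h x × x ∙ h ≈ h' → IsEdge (h ∙ k) x × x ∙ (h ∙ k) ≈ h' ∙ k
  edge-∙ʳ {h} {x = x} ((x∈X , sh , sxh) , xh≈h') =
    (x∈X , S-∙ʳ sh , S-resp (assoc x h k) (S-∙ʳ sxh)) , trans (sym (assoc x h k)) (∙-congʳ xh≈h')

  step-∙ʳ : ∀ {h h'} → Step h h' → Step (h ∙ k) (h' ∙ k)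
  step-∙ʳ (inj₁ (x , edge)) = inj₁ (x , edge-∙ʳ edge)
  step-∙ʳ (inj₂ (inj₁ (x , edge))) = inj₂ (inj₁ (x , edge-∙ʳ edge))
  step-∙ʳ (inj₂ (inj₂ (sh , sh' , h≈h'))) = inj₂ (inj₂ (S-∙ʳ sh , S-∙ʳ sh' , ∙-congʳ h≈h'))

  connected-∙ʳ : ∀ {h h'} → Connected h h' → Connected (h ∙ k) (h' ∙ k)
  connected-∙ʳ (sh , sh' , walk) = S-∙ʳ sh , S-∙ʳ sh' , gmap (_∙ k) step-∙ʳ walk

module Preimage {c ℓ o e p q : Level} {G : Group c ℓ} (A : GroupAction G o e)
    (X : Group.Carrier G → Set p) (a : GroupAction.Ω A) (U : GroupAction.Ω A → Set q)
    (U-resp : ∀ {b b'} → GroupAction._≈Ω_ A b b' → U b → U b') where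
  open Group G renaming (ε to 1ᴳ)
  open GroupProperties G using (\\-leftDividesˡ; ∙-cancelʳ)
  open GroupAction A using (Ω; Ωs; _≈Ω_; _·_; ·-cong; ·-ident; ·-assoc)
  open Setoid Ωs using () renaming (refl to ≈Ω-refl; sym to ≈Ω-sym; trans to ≈Ω-trans)
  open ActionProperties A
  module Λ = ActionGraph.Full A X U

  ρ : Carrier → Ω
  ρ h = h · a

  ρ⁻¹U : Carrier → Set q
  ρ⁻¹U h = U (ρ h)

  Gₐ : Carrier → Set e
  Gₐ g = ρ g ≈Ω a

  open ActionGraph.Full (leftRegular G) X ρ⁻¹U

  ρ-cong : ∀ {h h'} → h ≈ h' → ρ h ≈Ω ρ h'
  ρ-cong h≈h' = ·-cong h≈h' ≈Ω-refl

  ρ-∙ : ∀ x h → ρ (x ∙ h) ≈Ω x · ρ h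
  ρ-∙ x h = ·-assoc x h a

  ρ1≈a : ρ 1ᴳ ≈Ω a
  ρ1≈a = ·-ident a

  ρ⁻¹U-resp : ∀ {h h'} → h ≈ h' → ρ⁻¹U h → ρ⁻¹U h'
  ρ⁻¹U-resp h≈h' = U-resp (ρ-cong h≈h')

  open FullSubgraph (leftRegular G) X ρ⁻¹U-resp

  \\-∈-Gₐ : ∀ {b c} → ρ b ≈Ω ρ c → Gₐ (b \\ c)
  \\-∈-Gₐ {b} {c} ρb≈ρc = begin
    ρ (b ⁻¹ ∙ c)      ≈⟨ ρ-∙ (b ⁻¹) c ⟩
    (b ⁻¹) · ρ c        ≈⟨ ·-cong refl ρb≈ρc ⟨
    (b ⁻¹) · (b · a)    ≈⟨ ·-inverseˡ b a ⟩
    a                 ∎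
    where open SetoidReasoning Ωs

  ρ-∙-Gₐ : ∀ {k} → Gₐ k → ∀ h → ρ (h ∙ k) ≈Ω ρ h
  ρ-∙-Gₐ {k} k∈Gₐ h = ≈Ω-trans (ρ-∙ h k) (·-cong refl k∈Gₐ)

  connected-∙-Gₐ : ∀ {k h h'} → Gₐ k → Connected h h' → Connected (h ∙ k) (h' ∙ k)
  connected-∙-Gₐ k∈Gₐ =
    RightTranslation.connected-∙ʳ {G = G} X ρ⁻¹U-resp (λ {h} → U-resp (≈Ω-sym (ρ-∙-Gₐ k∈Gₐ h)))

  lift-step : ∀ {s s' h} → Λ.Step s s' → ρ⁻¹U h → ρ h ≈Ω s →
              Σ Carrier λ h' → Connected h h' × ρ h' ≈Ω s'
  lift-step {s} {h = h} (inj₁ (x , (x∈X , _ , uxs) , xs≈s')) sh ρh≈s =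
    x ∙ h , edge⇒connected x∈X sh (U-resp (≈Ω-sym ρxh≈xs) uxs) , ≈Ω-trans ρxh≈xs xs≈s'
    where
    ρxh≈xs : ρ (x ∙ h) ≈Ω x · s
    ρxh≈xs = ≈Ω-trans (ρ-∙ x h) (·-cong refl ρh≈s)
  lift-step {s' = s'} {h} (inj₂ (inj₁ (x , (x∈X , us' , _) , xs'≈s))) sh ρh≈s =
    x \\ h , connected-sym (connected-respʳ (\\-leftDividesˡ x h) x\\h~xx\\h) , ρx\\h≈s'
    where
    ρx\\h≈s' : ρ (x \\ h) ≈Ω s'
    ρx\\h≈s' = begin
      ρ (x ⁻¹ ∙ h)     ≈⟨ ρ-∙ (x ⁻¹) h ⟩
      (x ⁻¹) · ρ h       ≈⟨ ·-cong refl (≈Ω-trans ρh≈s (≈Ω-sym xs'≈s)) ⟩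
      (x ⁻¹) · (x · s')  ≈⟨ ·-inverseˡ x s' ⟩
      s'               ∎
      where open SetoidReasoning Ωs
    x\\h~xx\\h : Connected (x \\ h) (x ∙ (x \\ h))
    x\\h~xx\\h = edge⇒connected x∈X (U-resp (≈Ω-sym ρx\\h≈s') us')
                   (ρ⁻¹U-resp (sym (\\-leftDividesˡ x h)) sh)
  lift-step (inj₂ (inj₂ (_ , _ , s≈s'))) sh ρh≈s = _ , connected-refl sh , ≈Ω-trans ρh≈s s≈s'

  lift-walk : ∀ {s s' h} → Star Λ.Step s s' → ρ⁻¹U h → ρ h ≈Ω s →
              Σ Carrier λ h' → Connected h h' × ρ h' ≈Ω s'
  lift-walk ε sh ρh≈s = _ , connected-refl sh , ρh≈s
  lift-walk (step ◅ walk) sh ρh≈s with lift-step step sh ρh≈s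
  ... | h₁ , h~h₁ @ (_ , sh₁ , _) , ρh₁≈s₁ with lift-walk walk sh₁ ρh₁≈s₁
  ...   | h' , h₁~h' , ρh'≈s' = h' , connected-trans h~h₁ h₁~h' , ρh'≈s'

  C₁∩Gₐ-trivial : Set (c ⊔ ℓ ⊔ e ⊔ p ⊔ q)
  C₁∩Gₐ-trivial = ∀ g → (Connected 1ᴳ g × Gₐ g) ⇔ g ≈ 1ᴳ

  EachComponentIsomorphic : Set (c ⊔ ℓ ⊔ o ⊔ e ⊔ p ⊔ q)
  EachComponentIsomorphic = ∀ g → ρ⁻¹U g → RestrictsToIso (leftRegular G) A X ρ (Connected g) U

  module _ (a∈U : U a) (Λ-connected : Λ.IsConnectedGraph) where

    1∈ρ⁻¹U : ρ⁻¹U 1ᴳ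
    1∈ρ⁻¹U = U-resp (≈Ω-sym ρ1≈a) a∈U

    ≈1⇒∈C₁∩Gₐ : ∀ {g} → g ≈ 1ᴳ → Connected 1ᴳ g × Gₐ g
    ≈1⇒∈C₁∩Gₐ g≈1 = ≈⇒connected 1∈ρ⁻¹U (sym g≈1) , ≈Ω-trans (ρ-cong g≈1) ρ1≈a

    lift-vertex : ∀ {g t} → ρ⁻¹U g → U t → Σ Carrier λ h → Connected g h × ρ h ≈Ω t
    lift-vertex sg ut with Λ-connected _ _ sg ut
    ... | _ , _ , walk = lift-walk walk sg ≈Ω-refl

    module _ (C₁∩Gₐ⊆1 : ∀ {g} → Connected 1ᴳ g → Gₐ g → g ≈ 1ᴳ) where

      C₁-injective : ∀ {c c'} → Connected 1ᴳ c → Connected 1ᴳ c' → ρ c ≈Ω ρ c' → c ≈ c'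
      C₁-injective {c} {c'} 1~c 1~c' ρc≈ρc' = begin
        c         ≈⟨ identityʳ c ⟨
        c ∙ 1ᴳ    ≈⟨ ∙-congˡ (C₁∩Gₐ⊆1 1~k k∈Gₐ) ⟨
        c ∙ k     ≈⟨ \\-leftDividesˡ c c' ⟩
        c'        ∎
        where
        open SetoidReasoning setoid
        k : Carrier
        k = c \\ c'
        k∈Gₐ : Gₐ k
        k∈Gₐ = \\-∈-Gₐ ρc≈ρc'
        k~c' : Connected k c'
        k~c' = connected-respʳ (\\-leftDividesˡ c c')
                 (connected-respˡ (identityˡ k) (connected-∙-Gₐ k∈Gₐ 1~c))
        1~k : Connected 1ᴳ k
        1~k = connected-trans 1~c' (connected-sym k~c')

      component-injective : ∀ {b b'} → Connected b b' → ρ b ≈Ω ρ b' → b ≈ b'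
      component-injective {b} {b'} b~b' @ (sb , _ , _) ρb≈ρb' with lift-vertex 1∈ρ⁻¹U sb
      ... | c , 1~c , ρc≈ρb = ∙-cancelʳ m b b' (trans bm≈c (C₁-injective 1~c 1~b'm ρc≈ρb'm))
        where
        m : Carrier
        m = b \\ c
        m∈Gₐ : Gₐ m
        m∈Gₐ = \\-∈-Gₐ (≈Ω-sym ρc≈ρb)
        bm≈c : b ∙ m ≈ c
        bm≈c = \\-leftDividesˡ b c
        1~b'm : Connected 1ᴳ (b' ∙ m)
        1~b'm = connected-trans 1~c (connected-respˡ bm≈c (connected-∙-Gₐ m∈Gₐ b~b'))
        ρc≈ρb'm : ρ c ≈Ω ρ (b' ∙ m)
        ρc≈ρb'm = ≈Ω-trans ρc≈ρb (≈Ω-trans ρb≈ρb' (≈Ω-sym (ρ-∙-Gₐ m∈Gₐ b')))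

      components-isomorphic : EachComponentIsomorphic
      components-isomorphic g sg = record
        { vertex-maps = λ _ (_ , sb , _) → sb
        ; edge-maps   = λ b x (x∈X , (_ , sb , _) , (_ , sxb , _)) →
                          (x∈X , sb , U-resp (ρ-∙ x b) sxb) , ρ-∙ x b
        ; vertex-inj  = λ _ _ → injective
        ; vertex-surj = λ _ → lift-vertex sg
        ; edge-inj    = λ _ _ _ _ (_ , g~b , _) (_ , g~b' , _) ρb≈ρb' x≈x' →
                          injective g~b g~b' ρb≈ρb' , x≈x'
        ; edge-surj   = edge-surj
        }
        where
        injective : ∀ {b b'} → Connected g b → Connected g b' → ρ b ≈Ω ρ b' → b ≈ b'
        injective g~b g~b' = component-injective (connected-trans (connected-sym g~b) g~b')

        edge-surj : ∀ t y → Λ.IsEdge t y → Σ Carrier λ b → Σ Carrier λ x →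
                      (X x × Connected g b × Connected g (x ∙ b)) × ρ b ≈Ω t × x ≈ y
        edge-surj t y (y∈X , ut , uyt) with lift-vertex sg ut
        ... | b , g~b @ (_ , sb , _) , ρb≈t =
          b , y , (y∈X , g~b , connected-trans g~b (edge⇒connected y∈X sb syb)) , ρb≈t , refl
          where
          syb : ρ⁻¹U (y ∙ b)
          syb = U-resp (≈Ω-sym (≈Ω-trans (ρ-∙ y b) (·-cong refl ρb≈t))) uyt

    C₁∩Gₐ-trivial⇒isomorphic : C₁∩Gₐ-trivial → EachComponentIsomorphic
    C₁∩Gₐ-trivial⇒isomorphic trivial =
      components-isomorphic (λ {g} 1~g g∈Gₐ → Equivalence.to (trivial g) (1~g , g∈Gₐ))

    isomorphic⇒C₁∩Gₐ-trivial : EachComponentIsomorphic → C₁∩Gₐ-trivial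
    isomorphic⇒C₁∩Gₐ-trivial iso g = mk⇔ ∈C₁∩Gₐ⇒≈1 ≈1⇒∈C₁∩Gₐ
      where
      ∈C₁∩Gₐ⇒≈1 : Connected 1ᴳ g × Gₐ g → g ≈ 1ᴳ
      ∈C₁∩Gₐ⇒≈1 (1~g , g∈Gₐ) = sym (RestrictsToIso.vertex-inj (iso 1ᴳ 1∈ρ⁻¹U) 1ᴳ g
                                  (connected-refl 1∈ρ⁻¹U) 1~g (≈Ω-trans ρ1≈a (≈Ω-sym g∈Gₐ)))

mainTheorem12 :
  ∀ {c ℓ o e p q : Level} (G : Group c ℓ) (A : GroupAction G o e)
    (X : Group.Carrier G → Set p)
    (X-resp : ∀ {x y} → Group._≈_ G x y → X x → X y)
    (X-sym : ∀ x → X x → X (Group._⁻¹ G x))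
    (a : GroupAction.Ω A) (U : GroupAction.Ω A → Set q)
    (U-resp : ∀ {b b'} → GroupAction._≈Ω_ A b b' → U b → U b')
    (a∈U : U a)
    (Λ-connected : ActionGraph.Full.IsConnectedGraph A X U) →
  ((g : Group.Carrier G) → U (GroupAction._·_ A g a) →
     RestrictsToIso (leftRegular G) A X (λ h → GroupAction._·_ A h a)
       (λ h → ActionGraph.Full.Connected (leftRegular G) X
                (λ k → U (GroupAction._·_ A k a)) g h)
       U)
  ⇔
  ((g : Group.Carrier G) →
     (ActionGraph.Full.Connected (leftRegular G) X
        (λ k → U (GroupAction._·_ A k a)) (Group.ε G) g
      × GroupAction._≈Ω_ A (GroupAction._·_ A g a) a)
     ⇔ Group._≈_ G g (Group.ε G))
mainTheorem12 G A X _ _ a U U-resp a∈U Λ-connected =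
  mk⇔ (isomorphic⇒C₁∩Gₐ-trivial a∈U Λ-connected) (C₁∩Gₐ-trivial⇒isomorphic a∈U Λ-connected)
  where open Preimage A X a U U-resp
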